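{- Let $G$ be an infinite connected bipartite dHp graph with sides $A$ and $B$. If for each $v\in B$, $N(v)$ is finite or $N(v)=A$, then some vertex of $A$ has infinite degree.
   Context: For $X\subseteq V(G)$ with $|X|\ge 2$, $N^2(X)$ denotes the set of vertices of $G$ having at least two neighbours in $X$. A bipartite graph $G$ with sides $A$ and $B$ is a dHp graph if $|A|\ge 2$ and $|N^2(X)|\ge |X|$ for every $X\subseteq A$ with $|X|\ge 2$. $N(v)$ is the set of neighbours of $v$. -}

module Defs where

open import Data.Empty using (⊥)
open import Data.Sum using (_⊎_; inj₁; inj₂)
open import Data.Product using (Σ; Σ-syntax; _×_)
open import Data.List using (List)
open import Data.List.Membership.Propositional using (_∈_)
open import Relation.Nullary using (¬_)
open import Relation.Binary.PropositionalEquality using (_≡_; _≢_)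
open import Relation.Binary.Construct.Closure.ReflexiveTransitive using (Star)

record BipGraph : Set₁ where
  field
    A : Set
    B : Set
    E : A → B → Set

Finite : {T : Set} → (T → Set) → Set
Finite {T} P = Σ[ xs ∈ List T ] (∀ x → P x → x ∈ xs)

Infinite : {T : Set} → (T → Set) → Set
Infinite P = ¬ Finite P

module _ (G : BipGraph) where
  open BipGraph G

  Vertex : Set
  Vertex = A ⊎ B

  Adj : Vertex → Vertex → Set
  Adj (inj₁ a) (inj₂ b) = E a b
  Adj (inj₂ b) (inj₁ a) = E a b
  Adj _ _ = ⊥

  InfiniteGraph : Set
  InfiniteGraph = Infinite {Vertex} (λ _ → Data.Unit.⊤)
    where import Data.Unit

  Connected : Set
  Connected = ∀ u v → Star Adj u v

  NA : A → B → Set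
  NA a b = E a b

  NB : B → A → Set
  NB b a = E a b

  N² : (A → Set) → B → Set
  N² X b = Σ[ a ∈ A ] Σ[ a' ∈ A ] (a ≢ a' × X a × X a' × E a b × E a' b)

  AtLeastTwo : {T : Set} → (T → Set) → Set
  AtLeastTwo {T} X = Σ[ x ∈ T ] Σ[ y ∈ T ] (x ≢ y × X x × X y)

  CardLeq : {S T : Set} → (S → Set) → (T → Set) → Set
  CardLeq {S} {T} X Y =
    Σ[ f ∈ ((s : S) → X s → T) ]
      ((∀ s (p : X s) → Y (f s p)) ×
       (∀ s s' (p : X s) (p' : X s') → f s p ≡ f s' p' → s ≡ s'))

  IsDHP : Set₁
  IsDHP = AtLeastTwo {A} (λ _ → Data.Unit.⊤)
        × (∀ (X : A → Set) → AtLeastTwo X → CardLeq X (N² X))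
    where import Data.Unit

-- Suppose every vertex of A has finite degree and fix a₀ ∈ A. As G is infinite and
-- connected, A is infinite, so we can greedily choose |N(a₀)| + 2 vertices of A, each
-- avoiding the finitely many vertices that share with an earlier choice a neighbour
-- of finite degree. Two chosen vertices then only have common neighbours b with
-- N(b) = A, and these all lie in N(a₀). For the chosen set X this gives
-- N²(X) ⊆ N(a₀), so |N²(X)| < |X|, contradicting the dHp condition.
module Submission where

open import Defs
open import Data.Empty using (⊥-elim)
open import Data.Fin using (Fin)
open import Data.Fin.Properties using (injective⇒≤)
open import Data.List as List using (List; []; _∷_; concatMap; length)
open import Data.List.Membership.Propositional using (_∉_; lose)
  renaming (_∈_ to _∈ₗ_)
open import Data.List.Membership.Propositional.Properties
  using (∈-++⁺ˡ; ∈-++⁺ʳ; ∈-map⁺; ∈-concatMap⁺)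
open import Data.List.Relation.Unary.Any using (here; there; index)
open import Data.List.Relation.Unary.Any.Properties using (lookup-index)
open import Data.Nat using (ℕ; zero; suc; _+_; _≤_)
open import Data.Nat.Properties using (1+n≰n; n≤1+n; ≤-trans)
open import Data.Product using (Σ-syntax; _×_; _,_; proj₁; proj₂; ∃)
open import Data.Sum using (_⊎_; inj₁; inj₂; [_,_]′)
open import Data.Unit using (⊤)
open import Data.Vec as Vec using (Vec; []; _∷_; toList)
open import Data.Vec.Membership.Propositional using (_∈_)
open import Data.Vec.Membership.Propositional.Properties using (∈-lookup; ∈-toList⁺)
open import Data.Vec.Relation.Unary.All as All using (All; _∷_)
open import Data.Vec.Relation.Unary.All.Properties using (lookup⁻)
open import Data.Vec.Relation.Unary.Any using (here; there)
open import Data.Vec.Relation.Unary.AllPairs as AllPairs using (AllPairs; []; _∷_)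
open import Data.Vec.Relation.Unary.Unique.Propositional using (Unique)
open import Data.Vec.Relation.Unary.Unique.Propositional.Properties using (lookup-injective)
open import Function using (_∘_; id; const)
open import Relation.Binary.Definitions using (Symmetric)
open import Relation.Binary.PropositionalEquality using (_≡_; _≢_; refl; cong; module ≡-Reasoning)
open import Relation.Binary.Construct.Closure.ReflexiveTransitive using (_◅_)
open import Relation.Nullary using (¬_)

module Classical (LEM : (P : Set) → P ⊎ ¬ P) where

  by-contradiction : {P : Set} → ¬ ¬ P → P
  by-contradiction {P} ¬¬p = [ id , ⊥-elim ∘ ¬¬p ]′ (LEM P)

  ¬∀⇒∃¬ : {T : Set} {P : T → Set} → ¬ (∀ x → P x) → ∃ λ x → ¬ P x
  ¬∀⇒∃¬ ¬∀ = by-contradiction λ ¬∃ → ¬∀ λ x → by-contradiction λ ¬px → ¬∃ (x , ¬px)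

Inexhaustible : Set → Set
Inexhaustible T = (xs : List T) → ∃ λ x → x ∉ xs

unique-injection⇒≤ : {S T : Set} {n : ℕ} {xs : Vec S n} {ys : List T} → Unique xs →
  (f : ∀ s → s ∈ xs → T) → (∀ s p → f s p ∈ₗ ys) →
  (∀ s s' p p' → f s p ≡ f s' p' → s ≡ s') → n ≤ length ys
unique-injection⇒≤ {xs = xs} {ys} unique f f∈ys f-injective = injective⇒≤ position-injective
  where
  image∈ys : ∀ i → f (Vec.lookup xs i) (∈-lookup i xs) ∈ₗ ys
  image∈ys i = f∈ys _ (∈-lookup i xs)

  position : Fin _ → Fin (length ys)
  position i = index (image∈ys i)

  position-injective : ∀ {i j} → position i ≡ position j → i ≡ j
  position-injective {i} {j} eq = lookup-injective unique i j (f-injective _ _ _ _ (begin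
    f (Vec.lookup xs i) _       ≡⟨ lookup-index (image∈ys i) ⟩
    List.lookup ys (position i) ≡⟨ cong (List.lookup ys) eq ⟩
    List.lookup ys (position j) ≡⟨ lookup-index (image∈ys j) ⟨
    f (Vec.lookup xs j) _       ∎))
    where open ≡-Reasoning

module _ {A : Set} {R : A → A → Set} (R-sym : Symmetric R) where

  allPairs-members : ∀ {n} {xs : Vec A n} {x y} → AllPairs R xs →
    x ∈ xs → y ∈ xs → x ≢ y → R x y
  allPairs-members (_ ∷ _)   (here refl) (here refl) x≢y = ⊥-elim (x≢y refl)
  allPairs-members (rx ∷ _)  (here refl) (there y∈)  _   = All.lookup rx y∈
  allPairs-members (ry ∷ _)  (there x∈)  (here refl) _   = R-sym (All.lookup ry x∈)
  allPairs-members (_ ∷ rxs) (there x∈)  (there y∈)  x≢y = allPairs-members rxs x∈ y∈ x≢y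

  greedy-allPairs : (forbidden : A → List A) → (∀ {a a'} → a' ∉ forbidden a → R a a') →
    Inexhaustible A → ∀ n → Σ[ xs ∈ Vec A n ] AllPairs R xs
  greedy-allPairs forbidden outside⇒R inexhaustible = go
    where
    go : ∀ n → Σ[ xs ∈ Vec A n ] AllPairs R xs
    go zero = [] , []
    go (suc n)
      with xs , rxs ← go n
      with a , a∉ ← inexhaustible (concatMap forbidden (toList xs)) =
      a ∷ xs , lookup⁻ related ∷ rxs
      where
      related : ∀ i → R a (Vec.lookup xs i)
      related i = R-sym (outside⇒R λ a∈ →
        a∉ (∈-concatMap⁺ forbidden (lose (∈-toList⁺ (∈-lookup i xs)) a∈)))

module _ (G : BipGraph) where
  open BipGraph G

  connected⇒has-neighbour : Connected G → A → ∀ b → ∃ λ a → E a b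
  connected⇒has-neighbour connected a₀ b with connected (inj₂ b) (inj₁ a₀)
  ... | _◅_ {j = inj₁ a} e _ = a , e

  finite-A⇒finite-graph : (∀ a → Finite (NA G a)) → (∀ b → ∃ λ a → E a b) →
    (as : List A) → (∀ a → a ∈ₗ as) → Finite {Vertex G} (const ⊤)
  finite-A⇒finite-graph degree-finite has-neighbour as covers =
    List.map inj₁ as List.++ List.map inj₂ (concatMap N as) , vertex∈
    where
    N : A → List B
    N = proj₁ ∘ degree-finite

    vertex∈ : ∀ v → ⊤ → v ∈ₗ (List.map inj₁ as List.++ List.map inj₂ (concatMap N as))
    vertex∈ (inj₁ a) _ = ∈-++⁺ˡ (∈-map⁺ inj₁ (covers a))
    vertex∈ (inj₂ b) _ with a , e ← has-neighbour b =
      ∈-++⁺ʳ _ (∈-map⁺ inj₂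
        (∈-concatMap⁺ N (lose (covers a) (proj₂ (degree-finite a) b e))))

  module _ (dhp : IsDHP G)
           (finite-or-full : ∀ b → Finite (NB G b) ⊎ (∀ a → NB G b a))
           (degree-finite : ∀ a → Finite (NA G a)) where

    private
      a₀ : A
      a₀ = proj₁ (proj₁ dhp)

      N[a₀] : List B
      N[a₀] = proj₁ (degree-finite a₀)

      Separated : A → A → Set
      Separated a a' = a ≢ a' × (∀ b → E a b → E a' b → b ∈ₗ N[a₀])

      separated-sym : Symmetric Separated
      separated-sym (a≢a' , common) = (λ { refl → a≢a' refl }) , λ b e' e → common b e e'

      finite-neighbourhood : B → List A
      finite-neighbourhood b = [ proj₁ , const [] ]′ (finite-or-full b)

      finite-neighbourhood-or-full : ∀ {a b} → E a b → a ∈ₗ finite-neighbourhood b ⊎ E a₀ b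
      finite-neighbourhood-or-full {b = b} e with finite-or-full b
      ... | inj₁ (_ , covers) = inj₁ (covers _ e)
      ... | inj₂ full        = inj₂ (full a₀)

      forbidden : A → List A
      forbidden a = a ∷ concatMap finite-neighbourhood (proj₁ (degree-finite a))

      outside-forbidden⇒separated : ∀ {a a'} → a' ∉ forbidden a → Separated a a'
      outside-forbidden⇒separated {a} {a'} a'∉ = (λ { refl → a'∉ (here refl) }) , common
        where
        common : ∀ b → E a b → E a' b → b ∈ₗ N[a₀]
        common b e e' with finite-neighbourhood-or-full e'
        ... | inj₁ a'∈ = ⊥-elim (a'∉ (there
          (∈-concatMap⁺ finite-neighbourhood (lose (proj₂ (degree-finite a) b e) a'∈))))
        ... | inj₂ e₀  = proj₂ (degree-finite a₀) b e₀

      at-least-two : ∀ {n} {xs : Vec A (2 + n)} → AllPairs Separated xs → AtLeastTwo G (_∈ xs)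
      at-least-two (((a≢a' , _) ∷ _) ∷ _) = _ , _ , a≢a' , here refl , there (here refl)

    dHp⇒¬inexhaustible : ¬ Inexhaustible A
    dHp⇒¬inexhaustible inexhaustible = 1+n≰n (≤-trans (n≤1+n _) |X|≤|N[a₀]|)
      where
      chosen : Σ[ xs ∈ Vec A (2 + length N[a₀]) ] AllPairs Separated xs
      chosen = greedy-allPairs separated-sym forbidden outside-forbidden⇒separated
                 inexhaustible (2 + length N[a₀])

      X : A → Set
      X = _∈ proj₁ chosen

      N²X⊆N[a₀] : ∀ {b} → N² G X b → b ∈ₗ N[a₀]
      N²X⊆N[a₀] (_ , _ , a≢a' , a∈ , a'∈ , e , e') =
        proj₂ (allPairs-members separated-sym (proj₂ chosen) a∈ a'∈ a≢a') _ e e'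

      |X|≤|N[a₀]| : 2 + length N[a₀] ≤ length N[a₀]
      |X|≤|N[a₀]| with f , f∈N²X , f-injective ← proj₂ dhp X (at-least-two (proj₂ chosen)) =
        unique-injection⇒≤ (AllPairs.map proj₁ (proj₂ chosen))
          f (λ s p → N²X⊆N[a₀] (f∈N²X s p)) f-injective

proposition2p6 : (LEM : (P : Set) → P ⊎ ¬ P) → (G : BipGraph) →
    InfiniteGraph G → Connected G → IsDHP G →
    (∀ (v : BipGraph.B G) → Finite (NB G v) ⊎ (∀ a → NB G v a)) →
    Σ[ a ∈ BipGraph.A G ] Infinite (NA G a)
proposition2p6 LEM G infinite connected dhp finite-or-full =
  by-contradiction λ no-infinite-degree →
    let degree-finite : ∀ a → Finite (NA G a)
        degree-finite = all-degrees-finite no-infinite-degree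
    in dHp⇒¬inexhaustible G dhp finite-or-full degree-finite
         (¬∀⇒∃¬ ∘ A-uncovered degree-finite)
  where
  open Classical LEM
  open BipGraph G using (A)

  all-degrees-finite : ¬ (Σ[ a ∈ A ] Infinite (NA G a)) → ∀ a → Finite (NA G a)
  all-degrees-finite no-infinite-degree a =
    by-contradiction λ infinite-degree → no-infinite-degree (a , infinite-degree)

  A-uncovered : (∀ a → Finite (NA G a)) → (as : List A) → ¬ (∀ a → a ∈ₗ as)
  A-uncovered degree-finite as covers = infinite (finite-A⇒finite-graph G degree-finite
    (connected⇒has-neighbour G connected (proj₁ (proj₁ dhp))) as covers)
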